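{- If $m$ is odd and $m>1$, then $[x^m]\left(\frac{x}{\log(1+x)}\right)^m=0$. If $m$ is even and $m>0$, then $[x^{m+1}]\left(\frac{x}{\log(1+x)}\right)^m=0$.
   Context: $\frac{x}{\log(1+x)}$ denotes the formal power series reciprocal to $\log(1+x)/x=\sum_{i\ge0}(-1)^i\frac{x^i}{i+1}$. For a power series $f(x)$, $[x^n]f(x)$ denotes the coefficient of $x^n$. -}

module Defs where

open import Data.Nat as ℕ using (ℕ; zero; suc; _∸_)
open import Data.Integer using (+_)
open import Relation.Binary.PropositionalEquality using (_≡_)
open import Data.Rational using (ℚ; 0ℚ; 1ℚ; _+_; _*_; -_; _/_)

Series : Set
Series = ℕ → ℚ

coeff : Series → ℕ → ℚ
coeff f n = f n

sumTo : ℕ → (ℕ → ℚ) → ℚ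
sumTo zero    g = g zero
sumTo (suc n) g = sumTo n g + g (suc n)

_⋆_ : Series → Series → Series
(f ⋆ g) n = sumTo n (λ k → f k * g (n ∸ k))

oneS : Series
oneS zero    = 1ℚ
oneS (suc _) = 0ℚ

powS : Series → ℕ → Series
powS f zero    = oneS
powS f (suc m) = f ⋆ powS f m

sgn : ℕ → ℚ
sgn zero    = 1ℚ
sgn (suc i) = - sgn i

-- log(1+x)/x = Σ_{i≥0} (-1)^i x^i/(i+1)
logSeries : Series
logSeries i = sgn i * (+ 1 / suc i)

-- B is the reciprocal of log(1+x)/x, i.e. B = x / log(1+x)
IsXOverLog : Series → Set
IsXOverLog B = ∀ n → coeff (logSeries ⋆ B) n ≡ oneS n

module Submission where

-- Notation: ℓ = log(1+x)/x (so that B = 1/ℓ), I = 1/(1+x), θ = x·d/dx.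
--
-- (1) Riccati equation.  Since θℓ = I - ℓ, applying θ to ℓB = 1 gives
--     θB = B - B²I, and by the Leibniz rule θ(Bᵏ) = k(Bᵏ - Bᵏ⁺¹I).  Comparing the
--     coefficients of xᵏ and xᵏ⁺¹ yields  [xᵏ](Bᵏ⁺¹I) = 0 for k ≥ 1  and
--     [xᵏ⁺¹]Bᵏ = -k·[xᵏ⁺¹](Bᵏ⁺¹I).
-- (2) The involution σ = -x/(1+x).  Substitution g ↦ g(σ) is a ring endomorphism
--     obeying the chain rule θ(g(σ)) = I·(θg)(σ).  As log(1+σ) = -log(1+x), one
--     gets B(σ)(1+x) = B, hence Bᵐ = Bᵐ(σ)(1+x)ᵐ.  Since σⁱ(1+x)ᵐ⁻¹ has no xᵐ term
--     for i < m, [xᵐ] g(σ)(1+x)ᵐ⁻¹ = (-1)ᵐ gₘ, and therefore [xᵐ](BᵐI) = (-1)ᵐ[xᵐ]Bᵐ.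
-- (3) For odd m ≥ 3, [xᵐ]Bᵐ = [xᵐ](BᵐI) + [xᵐ⁻¹](BᵐI) = -[xᵐ]Bᵐ + 0, so it is 0;
--     for even m ≥ 2, [xᵐ⁺¹]Bᵐ = -m[xᵐ⁺¹](Bᵐ⁺¹I) = m[xᵐ⁺¹]Bᵐ⁺¹ = 0 by the odd case.
--
-- Identities between series are proved modulo x^(N+1) for every N: truncated
-- series form a commutative ring, so the ring solver does the algebra, and the
-- substitution g(σ) only needs to be computed to N nested Horner steps.

open import Defs
open import Data.Nat using (ℕ; _<_; _%_; suc)
open import Data.Rational using (0ℚ)
open import Data.Product using (_×_)
open import Relation.Binary.PropositionalEquality using (_≡_)

open import Level using (0ℓ)
open import Data.Nat as ℕ using (zero; _≤_; z≤n; s≤s; _∸_)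
import Data.Nat.Properties as ℕP
import Data.Nat.Coprimality as Coprimality
import Data.Integer as ℤ
import Data.Integer.Solver as ℤSolver
open import Data.Rational using (ℚ; 1ℚ; ½; _+_; _*_; -_; _/_; mkℚ)
import Data.Rational.Properties as ℚP
import Data.Rational.Solver as ℚSolver
import Data.Rational.Unnormalised as ℚᵘ
import Data.Rational.Unnormalised.Properties as ℚᵘP
open import Data.Product using (_,_)
open import Data.Maybe using (Maybe; just; nothing)
open import Relation.Nullary using (yes; no)
open import Relation.Binary.PropositionalEquality using (refl; sym; trans; cong; cong₂; module ≡-Reasoning)
open import Algebra.Bundles using (CommutativeRing; CommutativeMonoid)
import Algebra.Solver.Ring.AlmostCommutativeRing as ACR
open import Algebra.Properties.CommutativeSemigroup (CommutativeMonoid.commutativeSemigroup ℚP.+-0-commutativeMonoid) using (interchange)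
open import Algebra.Properties.Group ℚP.+-0-group using () renaming (⁻¹-involutive to neg-involutive)

infix 4 _≐_ _≃[_]_
_≐_ : Series → Series → Set
f ≐ g = ∀ n → f n ≡ g n

_≃[_]_ : Series → ℕ → Series → Set
f ≃[ N ] g = ∀ n → n ≤ N → f n ≡ g n

≐⇒≃ : ∀ {N f g} → f ≐ g → f ≃[ N ] g
≐⇒≃ e n _ = e n

infixl 6 _⊕_
_⊕_ : Series → Series → Series
(f ⊕ g) n = f n + g n

⊖_ : Series → Series
(⊖ f) n = - f n

infixr 7 _·_
_·_ : ℚ → Series → Series
(c · f) n = c * f n

zeroS : Series
zeroS _ = 0ℚ

constS : ℚ → Series
constS c zero    = c
constS c (suc _) = 0ℚ

tailS : Series → Series
tailS f n = f (suc n)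

timesX : Series → Series
timesX f zero    = 0ℚ
timesX f (suc n) = f n

oneS≐constS : oneS ≐ constS 1ℚ
oneS≐constS zero    = refl
oneS≐constS (suc n) = refl

sumTo-cong : ∀ n {g h} → (∀ k → k ≤ n → g k ≡ h k) → sumTo n g ≡ sumTo n h
sumTo-cong zero    e = e 0 z≤n
sumTo-cong (suc n) e = cong₂ _+_ (sumTo-cong n (λ k k≤n → e k (ℕP.m≤n⇒m≤1+n k≤n))) (e (suc n) ℕP.≤-refl)

sumTo-front : ∀ n g → sumTo (suc n) g ≡ g 0 + sumTo n (λ k → g (suc k))
sumTo-front zero    g = refl
sumTo-front (suc n) g = trans (cong (_+ g (suc (suc n))) (sumTo-front n g))
  (ℚP.+-assoc (g 0) (sumTo n (λ k → g (suc k))) (g (suc (suc n))))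

sumTo-+ : ∀ n g h → sumTo n (λ k → g k + h k) ≡ sumTo n g + sumTo n h
sumTo-+ zero    g h = refl
sumTo-+ (suc n) g h = trans (cong (_+ (g (suc n) + h (suc n))) (sumTo-+ n g h))
  (interchange (sumTo n g) (sumTo n h) (g (suc n)) (h (suc n)))

sumTo-*ˡ : ∀ n c g → sumTo n (λ k → c * g k) ≡ c * sumTo n g
sumTo-*ˡ zero    c g = refl
sumTo-*ˡ (suc n) c g = trans (cong (_+ (c * g (suc n))) (sumTo-*ˡ n c g))
  (sym (ℚP.*-distribˡ-+ c (sumTo n g) (g (suc n))))

sumTo-zero : ∀ n g → (∀ k → k ≤ n → g k ≡ 0ℚ) → sumTo n g ≡ 0ℚ
sumTo-zero n g e = trans (sumTo-cong n e) (zeros n)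
  where
  zeros : ∀ n → sumTo n (λ _ → 0ℚ) ≡ 0ℚ
  zeros zero    = refl
  zeros (suc n) = cong (_+ 0ℚ) (zeros n)

sumTo-reverse : ∀ n g → sumTo n g ≡ sumTo n (λ k → g (n ∸ k))
sumTo-reverse zero    g = refl
sumTo-reverse (suc n) g = trans (cong (_+ g (suc n)) (sumTo-reverse n g))
  (trans (ℚP.+-comm (sumTo n (λ k → g (n ∸ k))) (g (suc n)))
         (sym (sumTo-front n (λ k → g (suc n ∸ k)))))

⋆-cong : ∀ N {f f' g g'} → f ≃[ N ] f' → g ≃[ N ] g' → f ⋆ g ≃[ N ] f' ⋆ g'
⋆-cong N ef eg n n≤N = sumTo-cong n (λ k k≤n →
  cong₂ _*_ (ef k (ℕP.≤-trans k≤n n≤N)) (eg (n ∸ k) (ℕP.≤-trans (ℕP.m∸n≤m n k) n≤N)))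

⋆-cong≐ : ∀ {f f' g g'} → f ≐ f' → g ≐ g' → f ⋆ g ≐ f' ⋆ g'
⋆-cong≐ ef eg n = sumTo-cong n (λ k _ → cong₂ _*_ (ef k) (eg (n ∸ k)))

⋆-comm : ∀ f g → f ⋆ g ≐ g ⋆ f
⋆-comm f g n = trans (sumTo-reverse n _) (sumTo-cong n (λ k k≤n →
  trans (cong (λ i → f (n ∸ k) * g i) (ℕP.m∸[m∸n]≡n k≤n)) (ℚP.*-comm (f (n ∸ k)) (g k))))

⋆-front : ∀ f g n → (f ⋆ g) (suc n) ≡ f 0 * g (suc n) + (tailS f ⋆ g) n
⋆-front f g n = sumTo-front n _

⋆-distribʳ : ∀ f g h → (f ⊕ g) ⋆ h ≐ (f ⋆ h) ⊕ (g ⋆ h)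
⋆-distribʳ f g h n = trans (sumTo-cong n (λ k _ → ℚP.*-distribʳ-+ (h (n ∸ k)) (f k) (g k))) (sumTo-+ n _ _)

⋆-distribˡ : ∀ f g h → f ⋆ (g ⊕ h) ≐ (f ⋆ g) ⊕ (f ⋆ h)
⋆-distribˡ f g h n = trans (⋆-comm f (g ⊕ h) n) (trans (⋆-distribʳ g h f n)
  (cong₂ _+_ (⋆-comm g f n) (⋆-comm h f n)))

⋆-scale : ∀ c f g → (c · f) ⋆ g ≐ c · (f ⋆ g)
⋆-scale c f g n = trans (sumTo-cong n (λ k _ → ℚP.*-assoc c (f k) (g (n ∸ k)))) (sumTo-*ˡ n c _)

⋆-zeroˡ : ∀ f g → f ≐ zeroS → f ⋆ g ≐ zeroS
⋆-zeroˡ f g e n = sumTo-zero n _ (λ k _ → trans (cong (_* g (n ∸ k)) (e k)) (ℚP.*-zeroˡ (g (n ∸ k))))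

constS-⋆ : ∀ c f → constS c ⋆ f ≐ c · f
constS-⋆ c f zero    = refl
constS-⋆ c f (suc n) = trans (⋆-front (constS c) f n)
  (trans (cong ((c * f (suc n)) +_) (⋆-zeroˡ (tailS (constS c)) f (λ _ → refl) n)) (ℚP.+-identityʳ (c * f (suc n))))

⋆-identityˡ : ∀ f → oneS ⋆ f ≐ f
⋆-identityˡ f n = trans (⋆-cong≐ {g = f} {g' = f} oneS≐constS (λ _ → refl) n)
  (trans (constS-⋆ 1ℚ f n) (ℚP.*-identityˡ (f n)))

⋆-identityʳ : ∀ f → f ⋆ oneS ≐ f
⋆-identityʳ f n = trans (⋆-comm f oneS n) (⋆-identityˡ f n)

⋆-assoc : ∀ n f g h → ((f ⋆ g) ⋆ h) n ≡ (f ⋆ (g ⋆ h)) n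
⋆-assoc zero    f g h = ℚP.*-assoc (f 0) (g 0) (h 0)
⋆-assoc (suc n) f g h = begin
  ((f ⋆ g) ⋆ h) (suc n)
    ≡⟨ ⋆-front (f ⋆ g) h n ⟩
  (f 0 * g 0) * h (suc n) + (tailS (f ⋆ g) ⋆ h) n
    ≡⟨ cong (((f 0 * g 0) * h (suc n)) +_) (⋆-cong≐ {g = h} {g' = h} (⋆-front f g) (λ _ → refl) n) ⟩
  (f 0 * g 0) * h (suc n) + (((f 0 · tailS g) ⊕ (tailS f ⋆ g)) ⋆ h) n
    ≡⟨ cong (((f 0 * g 0) * h (suc n)) +_) (trans (⋆-distribʳ (f 0 · tailS g) (tailS f ⋆ g) h n)
         (cong₂ _+_ (⋆-scale (f 0) (tailS g) h n) (⋆-assoc n (tailS f) g h))) ⟩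
  (f 0 * g 0) * h (suc n) + (f 0 * (tailS g ⋆ h) n + (tailS f ⋆ (g ⋆ h)) n)
    ≡⟨ regroup (f 0) (g 0) (h (suc n)) ((tailS g ⋆ h) n) ((tailS f ⋆ (g ⋆ h)) n) ⟩
  f 0 * (g 0 * h (suc n) + (tailS g ⋆ h) n) + (tailS f ⋆ (g ⋆ h)) n
    ≡⟨ cong (λ z → f 0 * z + (tailS f ⋆ (g ⋆ h)) n) (sym (⋆-front g h n)) ⟩
  f 0 * (g ⋆ h) (suc n) + (tailS f ⋆ (g ⋆ h)) n
    ≡⟨ sym (⋆-front f (g ⋆ h) n) ⟩
  (f ⋆ (g ⋆ h)) (suc n) ∎
  where
  open ≡-Reasoning
  open ℚSolver.+-*-Solver
  regroup : ∀ a b c d e → (a * b) * c + (a * d + e) ≡ a * (b * c + d) + e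
  regroup = solve 5 (λ a b c d e → (a :* b) :* c :+ (a :* d :+ e) := a :* (b :* c :+ d) :+ e) refl

constS-+ : ∀ a b → constS (a + b) ≐ constS a ⊕ constS b
constS-+ a b zero    = refl
constS-+ a b (suc n) = sym (ℚP.+-identityˡ 0ℚ)

constS-* : ∀ a b → constS (a * b) ≐ constS a ⋆ constS b
constS-* a b n = sym (trans (constS-⋆ a (constS b) n) (scaled n))
  where
  scaled : ∀ n → a * constS b n ≡ constS (a * b) n
  scaled zero    = refl
  scaled (suc n) = ℚP.*-zeroʳ a

module Truncated (N : ℕ) where
  ring : CommutativeRing 0ℓ 0ℓ
  ring = record
    { Carrier = Series ; _≈_ = λ f g → f ≃[ N ] g ; _+_ = _⊕_ ; _*_ = _⋆_ ; -_ = ⊖_ ; 0# = zeroS ; 1# = oneS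
    ; isCommutativeRing = record
      { isRing = record
        { +-isAbelianGroup = record
          { isGroup = record
            { isMonoid = record
              { isSemigroup = record
                { isMagma = record
                  { isEquivalence = record
                    { refl = λ _ _ → refl
                    ; sym = λ e n n≤N → sym (e n n≤N)
                    ; trans = λ e e' n n≤N → trans (e n n≤N) (e' n n≤N) }
                  ; ∙-cong = λ e e' n n≤N → cong₂ _+_ (e n n≤N) (e' n n≤N) }
                ; assoc = λ f g h n _ → ℚP.+-assoc (f n) (g n) (h n) }
              ; identity = (λ f n _ → ℚP.+-identityˡ (f n)) , (λ f n _ → ℚP.+-identityʳ (f n)) }
            ; inverse = (λ f n _ → ℚP.+-inverseˡ (f n)) , (λ f n _ → ℚP.+-inverseʳ (f n))
            ; ⁻¹-cong = λ e n n≤N → cong -_ (e n n≤N) }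
          ; comm = λ f g n _ → ℚP.+-comm (f n) (g n) }
        ; *-cong = ⋆-cong N
        ; *-assoc = λ f g h n _ → ⋆-assoc n f g h
        ; *-identity = (λ f → ≐⇒≃ (⋆-identityˡ f)) , (λ f → ≐⇒≃ (⋆-identityʳ f))
        ; distrib = (λ f g h → ≐⇒≃ (⋆-distribˡ f g h)) , (λ f g h → ≐⇒≃ (⋆-distribʳ g h f)) }
      ; *-comm = λ f g → ≐⇒≃ (⋆-comm f g) } }

  almostCommutativeRing : ACR.AlmostCommutativeRing 0ℓ 0ℓ
  almostCommutativeRing = ACR.fromCommutativeRing ring

  constS-homomorphism : ℚP.+-*-rawRing ACR.-Raw-AlmostCommutative⟶ almostCommutativeRing
  constS-homomorphism = record
    { ⟦_⟧ = constS
    ; +-homo = λ a b n _ → constS-+ a b n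
    ; *-homo = λ a b n _ → constS-* a b n
    ; -‿homo = λ { a zero _ → refl ; a (suc n) _ → refl }
    ; 0-homo = λ { zero _ → refl ; (suc n) _ → refl }
    ; 1-homo = λ { zero _ → refl ; (suc n) _ → refl } }

  constS≟ : ∀ a b → Maybe (constS a ≃[ N ] constS b)
  constS≟ a b with a ℚP.≟ b
  ... | yes refl = just (λ _ _ → refl)
  ... | no _     = nothing

  open import Algebra.Solver.Ring ℚP.+-*-rawRing almostCommutativeRing constS-homomorphism constS≟ public
  open CommutativeRing ring public
    using (+-cong; *-cong; zeroʳ; *-identityʳ; +-identityˡ; +-comm; -‿cong; setoid)
    renaming (refl to ≈-refl; sym to ≈-sym; trans to ≈-trans)
  open import Relation.Binary.Reasoning.Setoid setoid public

natQ : ℕ → ℚ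
natQ n = mkℚ (ℤ.+ n) 0 (Coprimality.sym (Coprimality.1-coprimeTo n))

natQ-zero : natQ 0 ≡ 0ℚ
natQ-zero = sym (ℚP.normalize-coprime (Coprimality.sym (Coprimality.1-coprimeTo 0)))

natQ-one : natQ 1 ≡ 1ℚ
natQ-one = sym (ℚP.normalize-coprime (Coprimality.sym (Coprimality.1-coprimeTo 1)))

-- n + 1 ↦ natQ n + 1, checked on the unnormalised representation n/1 + 1/1.
natQ-suc : ∀ n → natQ (suc n) ≡ natQ n + 1ℚ
natQ-suc n = sym (trans (cong (natQ n +_) (sym natQ-one))
  (ℚP.toℚᵘ-injective (ℚᵘP.≃-trans (ℚP.toℚᵘ-homo-+ (natQ n) (natQ 1)) (ℚᵘ.*≡* (cross-multiplied (ℤ.+ n))))))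
  where
  open ℤSolver.+-*-Solver
  cross-multiplied : ∀ (x : ℤ.ℤ) → (x ℤ.* ℤ.1ℤ ℤ.+ ℤ.1ℤ ℤ.* ℤ.1ℤ) ℤ.* ℤ.1ℤ ≡ (ℤ.1ℤ ℤ.+ x) ℤ.* (ℤ.1ℤ ℤ.* ℤ.1ℤ)
  cross-multiplied = solve 1 (λ x → (x :* con ℤ.1ℤ :+ con ℤ.1ℤ :* con ℤ.1ℤ) :* con ℤ.1ℤ
                                   := (con ℤ.1ℤ :+ x) :* (con ℤ.1ℤ :* con ℤ.1ℤ)) refl

natQ-+ : ∀ a b → natQ (a ℕ.+ b) ≡ natQ a + natQ b
natQ-+ zero    b = sym (trans (cong (_+ natQ b) natQ-zero) (ℚP.+-identityˡ (natQ b)))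
natQ-+ (suc a) b = begin
  natQ (suc (a ℕ.+ b))        ≡⟨ natQ-suc (a ℕ.+ b) ⟩
  natQ (a ℕ.+ b) + 1ℚ         ≡⟨ cong (_+ 1ℚ) (natQ-+ a b) ⟩
  (natQ a + natQ b) + 1ℚ      ≡⟨ swap (natQ a) (natQ b) ⟩
  (natQ a + 1ℚ) + natQ b      ≡⟨ cong (_+ natQ b) (sym (natQ-suc a)) ⟩
  natQ (suc a) + natQ b       ∎
  where
  open ≡-Reasoning
  open ℚSolver.+-*-Solver
  swap : ∀ x y → (x + y) + 1ℚ ≡ (x + 1ℚ) + y
  swap = solve 2 (λ x y → (x :+ y) :+ con 1ℚ := (x :+ con 1ℚ) :+ y) refl

natQ-inverse : ∀ k → (ℤ.+ 1 / suc k) * natQ (suc k) ≡ 1ℚ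
natQ-inverse k = trans (cong (_* natQ (suc k)) (ℚP.normalize-coprime (Coprimality.1-coprimeTo (suc k))))
  (ℚP.*-inverseˡ (natQ (suc k)))

natQ-cancel : ∀ k {a b} → natQ (suc k) * a ≡ natQ (suc k) * b → a ≡ b
natQ-cancel k {a} {b} e = begin
  a                                   ≡⟨ sym (ℚP.*-identityˡ a) ⟩
  1ℚ * a                              ≡⟨ cong (_* a) (sym (natQ-inverse k)) ⟩
  (r * natQ (suc k)) * a              ≡⟨ ℚP.*-assoc r (natQ (suc k)) a ⟩
  r * (natQ (suc k) * a)              ≡⟨ cong (r *_) e ⟩
  r * (natQ (suc k) * b)              ≡⟨ sym (ℚP.*-assoc r (natQ (suc k)) b) ⟩
  (r * natQ (suc k)) * b              ≡⟨ cong (_* b) (natQ-inverse k) ⟩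
  1ℚ * b                              ≡⟨ ℚP.*-identityˡ b ⟩
  b                                   ∎
  where
  open ≡-Reasoning
  r = ℤ.+ 1 / suc k

natQ-logSeries : ∀ k → natQ (suc k) * logSeries k ≡ sgn k
natQ-logSeries k = begin
  natQ (suc k) * (sgn k * r)   ≡⟨ rotate (natQ (suc k)) (sgn k) r ⟩
  sgn k * (r * natQ (suc k))   ≡⟨ cong (sgn k *_) (natQ-inverse k) ⟩
  sgn k * 1ℚ                   ≡⟨ ℚP.*-identityʳ (sgn k) ⟩
  sgn k                        ∎
  where
  open ≡-Reasoning
  open ℚSolver.+-*-Solver
  r = ℤ.+ 1 / suc k
  rotate : ∀ x y z → x * (y * z) ≡ y * (z * x)
  rotate = solve 3 (λ x y z → x :* (y :* z) := y :* (z :* x)) refl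

θ : Series → Series
θ f n = natQ n * f n

θ-cong : ∀ N {f g} → f ≃[ N ] g → θ f ≃[ N ] θ g
θ-cong N e n n≤N = cong (natQ n *_) (e n n≤N)

θ-⊕ : ∀ f g → θ (f ⊕ g) ≐ θ f ⊕ θ g
θ-⊕ f g n = ℚP.*-distribˡ-+ (natQ n) (f n) (g n)

θ-⊖ : ∀ f → θ (⊖ f) ≐ ⊖ θ f
θ-⊖ f n = sym (ℚP.neg-distribʳ-* (natQ n) (f n))

-- Leibniz rule, from n = k + (n - k) in each summand of the Cauchy product.
θ-Leibniz : ∀ f g → θ (f ⋆ g) ≐ (θ f ⋆ g) ⊕ (f ⋆ θ g)
θ-Leibniz f g n = trans (sym (sumTo-*ˡ n (natQ n) _))
  (trans (sumTo-cong n (λ k k≤n → trans (cong (λ z → z * (f k * g (n ∸ k)))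
      (trans (cong natQ (sym (ℕP.m+[n∸m]≡n k≤n))) (natQ-+ k (n ∸ k))))
      (distribute (natQ k) (natQ (n ∸ k)) (f k) (g (n ∸ k)))))
    (sumTo-+ n _ _))
  where
  open ℚSolver.+-*-Solver
  distribute : ∀ a b x y → (a + b) * (x * y) ≡ (a * x) * y + x * (b * y)
  distribute = solve 4 (λ a b x y → (a :+ b) :* (x :* y) := (a :* x) :* y :+ x :* (b :* y)) refl

θ-constS : ∀ c → θ (constS c) ≐ constS 0ℚ
θ-constS c zero    = trans (cong (_* c) natQ-zero) (ℚP.*-zeroˡ c)
θ-constS c (suc n) = ℚP.*-zeroʳ (natQ (suc n))

θ-oneS : θ oneS ≐ zeroS
θ-oneS zero    = θ-constS 1ℚ zero
θ-oneS (suc n) = θ-constS 1ℚ (suc n)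

tailS-θ : ∀ f → tailS (θ f) ≐ θ (tailS f) ⊕ tailS f
tailS-θ f n = trans (cong (_* f (suc n)) (natQ-suc n)) (distribute (natQ n) (f (suc n)))
  where
  open ℚSolver.+-*-Solver
  distribute : ∀ a x → (a + 1ℚ) * x ≡ a * x + x
  distribute = solve 2 (λ a x → (a :+ con 1ℚ) :* x := a :* x :+ x) refl

θ-injective : ∀ N {g h} → g 0 ≡ h 0 → θ g ≃[ N ] θ h → g ≃[ N ] h
θ-injective N e₀ e zero    _    = e₀
θ-injective N e₀ e (suc n) n≤N = natQ-cancel n (e (suc n) n≤N)

-- The series x, 1 + x, I = 1/(1+x) = Σ (-1)ⁿxⁿ, σ = -x/(1+x) = Σₙ≥₁ (-1)ⁿxⁿ,
-- and L = log(1+x) = x·ℓ, where ℓ = logSeries = log(1+x)/x.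

X : Series
X zero          = 0ℚ
X (suc zero)    = 1ℚ
X (suc (suc n)) = 0ℚ

onePlusX : Series
onePlusX = oneS ⊕ X

I : Series
I n = sgn n

σ : Series
σ zero    = 0ℚ
σ (suc n) = sgn (suc n)

L : Series
L = timesX logSeries

X-⋆ : ∀ f → X ⋆ f ≐ timesX f
X-⋆ f zero    = ℚP.*-zeroˡ (f 0)
X-⋆ f (suc n) = trans (⋆-front X f n) (trans (cong₂ _+_ (ℚP.*-zeroˡ (f (suc n)))
  (trans (⋆-cong≐ {g = f} {g' = f} tailX (λ _ → refl) n) (⋆-identityˡ f n)))
  (ℚP.+-identityˡ (f n)))
  where
  tailX : tailS X ≐ oneS
  tailX zero    = refl
  tailX (suc n) = refl

⋆-onePlusX : ∀ f → f ⋆ onePlusX ≐ f ⊕ timesX f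
⋆-onePlusX f n = trans (⋆-comm f onePlusX n) (trans (⋆-distribʳ oneS X f n)
  (cong₂ _+_ (⋆-identityˡ f n) (X-⋆ f n)))

-- Multiplying by 1 + x makes the alternating series telescope.

I-⋆-onePlusX : I ⋆ onePlusX ≐ oneS
I-⋆-onePlusX n = trans (⋆-onePlusX I n) (telescope n)
  where
  telescope : ∀ n → I n + timesX I n ≡ oneS n
  telescope zero    = ℚP.+-identityʳ 1ℚ
  telescope (suc n) = ℚP.+-inverseˡ (sgn n)

σ-⋆-onePlusX : σ ⋆ onePlusX ≐ ⊖ X
σ-⋆-onePlusX n = trans (⋆-onePlusX σ n) (telescope n)
  where
  telescope : ∀ n → σ n + timesX σ n ≡ (⊖ X) n
  telescope zero          = refl
  telescope (suc zero)    = refl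
  telescope (suc (suc n)) = ℚP.+-inverseˡ (- sgn n)

θσ-⋆-onePlusX : θ σ ⋆ onePlusX ≐ σ
θσ-⋆-onePlusX n = trans (⋆-onePlusX (θ σ) n) (telescope n)
  where
  open ℚSolver.+-*-Solver
  step : ∀ a s → (a + 1ℚ) * - (- s) + a * - s ≡ - (- s)
  step = solve 2 (λ a s → (a :+ con 1ℚ) :* (:- (:- s)) :+ a :* (:- s) := :- (:- s)) refl
  telescope : ∀ n → θ σ n + timesX (θ σ) n ≡ σ n
  telescope zero          = trans (ℚP.+-identityʳ _) (trans (cong (_* 0ℚ) natQ-zero) (ℚP.*-zeroˡ 0ℚ))
  telescope (suc zero)    = trans (ℚP.+-identityʳ _) (trans (cong (_* (- 1ℚ)) natQ-one) (ℚP.*-identityˡ (- 1ℚ)))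
  telescope (suc (suc n)) = trans (cong (λ a → a * (- (- sgn n)) + natQ (suc n) * (- sgn n)) (natQ-suc (suc n)))
    (step (natQ (suc n)) (sgn n))

-- θℓ = I - ℓ, i.e. (n+1)ℓₙ = (-1)ⁿ.
θ-logSeries : θ logSeries ≐ I ⊕ ⊖ logSeries
θ-logSeries n = begin
  natQ n * l                   ≡⟨ split (natQ n) l ⟩
  (natQ n + 1ℚ) * l + - l      ≡⟨ cong (λ a → a * l + - l) (sym (natQ-suc n)) ⟩
  natQ (suc n) * l + - l       ≡⟨ cong (_+ - l) (natQ-logSeries n) ⟩
  sgn n + - l                  ∎
  where
  open ≡-Reasoning
  open ℚSolver.+-*-Solver
  l = logSeries n
  split : ∀ a l → a * l ≡ (a + 1ℚ) * l + - l
  split = solve 2 (λ a l → a :* l := (a :+ con 1ℚ) :* l :+ :- l) refl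

θ-L : θ L ≐ timesX I
θ-L zero    = trans (cong (_* 0ℚ) natQ-zero) (ℚP.*-zeroˡ 0ℚ)
θ-L (suc n) = natQ-logSeries n

-- B = x/log(1+x) satisfies the Riccati equation θB = B - B²I: applying θ to
-- ℓB = 1 gives (I - ℓ)B + ℓ·θB = 0, and multiplying by B and using ℓB = 1 again
-- isolates θB.
riccati : ∀ {B} → IsXOverLog B → ∀ N → θ B ≃[ N ] B ⊕ ⊖ ((B ⋆ B) ⋆ I)
riccati {B} ℓB≐1 N = begin
    θ B
  ≈⟨ ≈-sym (≈-trans (*-cong (≈-refl {θ B}) (≐⇒≃ ℓB≐1)) (*-identityʳ (θ B))) ⟩
    θ B ⋆ (ℓ ⋆ B)
  ≈⟨ solve 4 (λ t l b i → t :* (l :* b) := b :* (((i :- l) :* b) :+ (l :* t)) :+ (b :* (l :* b) :- (b :* b) :* i))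
       (λ _ _ → refl) (θ B) ℓ B I ⟩
    B ⋆ θ[ℓB] ⊕ (B ⋆ (ℓ ⋆ B) ⊕ ⊖ ((B ⋆ B) ⋆ I))
  ≈⟨ +-cong (*-cong (≈-refl {B}) θ[ℓB]≃0) (+-cong (*-cong (≈-refl {B}) (≐⇒≃ ℓB≐1)) (≈-refl {⊖ ((B ⋆ B) ⋆ I)})) ⟩
    B ⋆ zeroS ⊕ (B ⋆ oneS ⊕ ⊖ ((B ⋆ B) ⋆ I))
  ≈⟨ ≈-trans (+-cong (zeroʳ B) (+-cong (*-identityʳ B) (≈-refl {⊖ ((B ⋆ B) ⋆ I)})))
             (+-identityˡ (B ⊕ ⊖ ((B ⋆ B) ⋆ I))) ⟩
    B ⊕ ⊖ ((B ⋆ B) ⋆ I) ∎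
  where
  open Truncated N
  ℓ = logSeries
  -- θ(ℓB) by the Leibniz rule, with θℓ = I - ℓ substituted.
  θ[ℓB] = ((I ⊕ ⊖ ℓ) ⋆ B) ⊕ (ℓ ⋆ θ B)
  θ[ℓB]≃0 : θ[ℓB] ≃[ N ] zeroS
  θ[ℓB]≃0 = ≈-trans (+-cong (*-cong (≐⇒≃ (λ n → sym (θ-logSeries n))) (≈-refl {B})) (≈-refl {ℓ ⋆ θ B}))
            (≈-trans (≈-sym (≐⇒≃ (θ-Leibniz ℓ B))) (≈-trans (θ-cong N (≐⇒≃ ℓB≐1)) (≐⇒≃ θ-oneS)))

module RiccatiPowers (B : Series) (ode : ∀ N → θ B ≃[ N ] B ⊕ ⊖ ((B ⋆ B) ⋆ I)) where
  E : ℕ → Series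
  E k = powS B (suc k) ⋆ I

  θ-powS : ∀ N k → θ (powS B k) ≃[ N ] constS (natQ k) ⋆ (powS B k ⊕ ⊖ E k)
  θ-powS N zero = ≈-trans (≐⇒≃ θ-oneS) (≐⇒≃ (λ n → sym (vanishes n)))
    where
    open Truncated N
    vanishes : constS (natQ 0) ⋆ (oneS ⊕ ⊖ E 0) ≐ zeroS
    vanishes n = trans (constS-⋆ (natQ 0) (oneS ⊕ ⊖ E 0) n)
      (trans (cong (_* (oneS ⊕ ⊖ E 0) n) natQ-zero) (ℚP.*-zeroˡ ((oneS ⊕ ⊖ E 0) n)))
  θ-powS N (suc k) = begin
      θ (B ⋆ P)
    ≈⟨ ≐⇒≃ (θ-Leibniz B P) ⟩
      θ B ⋆ P ⊕ B ⋆ θ P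
    ≈⟨ +-cong (*-cong (ode N) (≈-refl {P})) (*-cong (≈-refl {B}) (θ-powS N k)) ⟩
      (B ⊕ ⊖ ((B ⋆ B) ⋆ I)) ⋆ P ⊕ B ⋆ (constS (natQ k) ⋆ (P ⊕ ⊖ ((B ⋆ P) ⋆ I)))
    ≈⟨ solve 4 (λ b p c i → (b :- (b :* b) :* i) :* p :+ b :* (c :* (p :- (b :* p) :* i))
                          := (c :+ con 1ℚ) :* (b :* p :- (b :* (b :* p)) :* i)) (λ _ _ → refl) B P (constS (natQ k)) I ⟩
      (constS (natQ k) ⊕ constS 1ℚ) ⋆ (B ⋆ P ⊕ ⊖ ((B ⋆ (B ⋆ P)) ⋆ I))
    ≈⟨ *-cong (≐⇒≃ (λ n → sym (trans (cong (λ a → constS a n) (natQ-suc k)) (constS-+ (natQ k) 1ℚ n))))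
              (≈-refl {B ⋆ P ⊕ ⊖ ((B ⋆ (B ⋆ P)) ⋆ I)}) ⟩
      constS (natQ (suc k)) ⋆ (B ⋆ P ⊕ ⊖ ((B ⋆ (B ⋆ P)) ⋆ I)) ∎
    where
    open Truncated N
    P = powS B k

  θ-powS-coeff : ∀ k n → natQ n * powS B k n ≡ natQ k * (powS B k n + - E k n)
  θ-powS-coeff k n = trans (θ-powS n k n ℕP.≤-refl) (constS-⋆ (natQ k) (powS B k ⊕ ⊖ E k) n)

  -- At n = k ≥ 1 the left side cancels: [xᵏ]Eₖ = 0.
  E-diagonal : ∀ j → E (suc j) (suc j) ≡ 0ℚ
  E-diagonal j = natQ-cancel j (trans (cancel a p e (θ-powS-coeff (suc j) (suc j))) (sym (ℚP.*-zeroʳ a)))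
    where
    a = natQ (suc j)
    p = powS B (suc j) (suc j)
    e = E (suc j) (suc j)
    open ℚSolver.+-*-Solver
    expand : ∀ a p e → a * e ≡ a * p + - (a * (p + - e))
    expand = solve 3 (λ a p e → a :* e := a :* p :+ :- (a :* (p :+ :- e))) refl
    cancel : ∀ a p e → a * p ≡ a * (p + - e) → a * e ≡ 0ℚ
    cancel a p e h = trans (expand a p e) (trans (cong (_+ - (a * (p + - e))) h) (ℚP.+-inverseʳ (a * (p + - e))))

  powS-offDiagonal : ∀ k → powS B k (suc k) ≡ - (natQ k * E k (suc k))
  powS-offDiagonal k = solveFor (natQ k) (powS B k (suc k)) (E k (suc k))
    (trans (cong (_* powS B k (suc k)) (sym (natQ-suc k))) (θ-powS-coeff k (suc k)))
    where
    open ℚSolver.+-*-Solver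
    expand : ∀ a p → p ≡ (a + 1ℚ) * p + - (a * p)
    expand = solve 2 (λ a p → p := (a :+ con 1ℚ) :* p :+ :- (a :* p)) refl
    simplify : ∀ a p e → a * (p + - e) + - (a * p) ≡ - (a * e)
    simplify = solve 3 (λ a p e → a :* (p :+ :- e) :+ :- (a :* p) := :- (a :* e)) refl
    solveFor : ∀ a p e → (a + 1ℚ) * p ≡ a * (p + - e) → p ≡ - (a * e)
    solveFor a p e h = trans (expand a p) (trans (cong (_+ - (a * p)) h) (simplify a p e))

-- Substitution of σ: f(σ) = f₀ + σ·(tailS f)(σ), unfolded N times.  As σ has no
-- constant term, the result is correct modulo x^(N+1).
atσ : ℕ → Series → Series
atσ zero    f = constS (f 0)
atσ (suc N) f = constS (f 0) ⊕ (σ ⋆ atσ N (tailS f))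

σ-⋆-zero : ∀ g → (σ ⋆ g) 0 ≡ 0ℚ
σ-⋆-zero g = ℚP.*-zeroˡ (g 0)

σ-⋆-suc : ∀ g n → (σ ⋆ g) (suc n) ≡ (tailS σ ⋆ g) n
σ-⋆-suc g n = trans (⋆-front σ g n) (trans (cong (_+ (tailS σ ⋆ g) n) (ℚP.*-zeroˡ (g (suc n)))) (ℚP.+-identityˡ _))

σ-⋆-lift : ∀ N {g h} → g ≃[ N ] h → σ ⋆ g ≃[ suc N ] σ ⋆ h
σ-⋆-lift N {g} {h} e zero    _           = trans (σ-⋆-zero g) (sym (σ-⋆-zero h))
σ-⋆-lift N {g} {h} e (suc n) (s≤s n≤N) =
  trans (σ-⋆-suc g n) (trans (⋆-cong N {tailS σ} {tailS σ} (λ _ _ → refl) e n n≤N) (sym (σ-⋆-suc h n)))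

atσ-constTerm : ∀ N f → atσ N f 0 ≡ f 0
atσ-constTerm zero    f = refl
atσ-constTerm (suc N) f = trans (cong (f 0 +_) (σ-⋆-zero (atσ N (tailS f)))) (ℚP.+-identityʳ (f 0))

atσ-cong : ∀ N {f g} → f ≐ g → atσ N f ≐ atσ N g
atσ-cong zero    e zero    = e 0
atσ-cong zero    e (suc n) = refl
atσ-cong (suc N) {f} {g} e n = cong₂ _+_ (cong (λ c → constS c n) (e 0))
  (⋆-cong≐ {σ} {σ} {atσ N (tailS f)} {atσ N (tailS g)} (λ _ → refl) (atσ-cong N (λ k → e (suc k))) n)

atσ-stable : ∀ N f → atσ N f ≃[ N ] atσ (suc N) f
atσ-stable zero    f zero _ = sym (atσ-constTerm 1 f)
atσ-stable (suc N) f = +-cong (≈-refl {constS (f 0)}) (σ-⋆-lift N (atσ-stable N (tailS f)))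
  where open Truncated (suc N)

atσ-⊕ : ∀ N f g → atσ N (f ⊕ g) ≐ atσ N f ⊕ atσ N g
atσ-⊕ zero    f g = constS-+ (f 0) (g 0)
atσ-⊕ (suc N) f g n = trans (cong₂ _+_ (constS-+ (f 0) (g 0) n)
    (trans (⋆-cong≐ {σ} {σ} (λ _ → refl) (atσ-⊕ N (tailS f) (tailS g)) n)
           (⋆-distribˡ σ (atσ N (tailS f)) (atσ N (tailS g)) n)))
  (interchange (constS (f 0) n) (constS (g 0) n) _ _)

atσ-zero : ∀ N f → f ≐ zeroS → atσ N f ≐ zeroS
atσ-zero zero    f e zero    = e 0
atσ-zero zero    f e (suc n) = refl
atσ-zero (suc N) f e n = trans (cong₂ _+_ (cong (λ c → constS c n) (e 0))
    (trans (⋆-comm σ (atσ N (tailS f)) n) (⋆-zeroˡ (atσ N (tailS f)) σ (atσ-zero N (tailS f) (λ k → e (suc k))) n)))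
  (constS-zero n)
  where
  constS-zero : ∀ n → constS 0ℚ n + 0ℚ ≡ 0ℚ
  constS-zero zero    = refl
  constS-zero (suc n) = refl

atσ-constS : ∀ N c → atσ N (constS c) ≐ constS c
atσ-constS zero    c zero    = refl
atσ-constS zero    c (suc n) = refl
atσ-constS (suc N) c n = trans (cong (constS c n +_)
    (trans (⋆-comm σ (atσ N (tailS (constS c))) n)
           (⋆-zeroˡ (atσ N (tailS (constS c))) σ (atσ-zero N (tailS (constS c)) (λ _ → refl)) n)))
  (ℚP.+-identityʳ (constS c n))

atσ-oneS : ∀ N → atσ N oneS ≐ oneS
atσ-oneS N n = trans (atσ-cong N oneS≐constS n) (trans (atσ-constS N 1ℚ n) (sym (oneS≐constS n)))

tailS-⋆ : ∀ f g → tailS (f ⋆ g) ≐ (constS (f 0) ⋆ tailS g) ⊕ (tailS f ⋆ g)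
tailS-⋆ f g n = trans (⋆-front f g n) (cong (_+ (tailS f ⋆ g) n) (sym (constS-⋆ (f 0) (tailS g) n)))

atσ-⋆ : ∀ N f g → atσ N (f ⋆ g) ≃[ N ] atσ N f ⋆ atσ N g
atσ-⋆ zero    f g zero _ = refl
atσ-⋆ (suc N) f g = begin
    constS ((f ⋆ g) 0) ⊕ σ ⋆ atσ N (tailS (f ⋆ g))
  ≈⟨ +-cong (≐⇒≃ (constS-* (f 0) (g 0))) (σ-⋆-lift N tail≃) ⟩
    (c ⋆ d) ⊕ σ ⋆ ((c ⋆ G) ⊕ (F ⋆ (d ⊕ σ ⋆ G)))
  ≈⟨ solve 5 (λ s c d F G → (c :* d) :+ s :* ((c :* G) :+ (F :* (d :+ s :* G))) := (c :+ s :* F) :* (d :+ s :* G))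
       (λ _ _ → refl) σ c d F G ⟩
    (c ⊕ σ ⋆ F) ⋆ (d ⊕ σ ⋆ G) ∎
  where
  open Truncated (suc N)
  c = constS (f 0)
  d = constS (g 0)
  F = atσ N (tailS f)
  G = atσ N (tailS g)
  tail≃ : atσ N (tailS (f ⋆ g)) ≃[ N ] (c ⋆ G) ⊕ (F ⋆ (d ⊕ σ ⋆ G))
  tail≃ = T.≈-trans (≐⇒≃ (atσ-cong N (tailS-⋆ f g)))
         (T.≈-trans (≐⇒≃ (atσ-⊕ N (c ⋆ tailS g) (tailS f ⋆ g)))
         (T.+-cong (T.≈-trans (atσ-⋆ N c (tailS g)) (T.*-cong (≐⇒≃ (atσ-constS N (f 0))) (T.≈-refl {G})))
                   (T.≈-trans (atσ-⋆ N (tailS f) g) (T.*-cong (T.≈-refl {F}) (atσ-stable N g)))))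
    where module T = Truncated N

-- θσ = σ·I, as θσ·(1+x) = σ and I·(1+x) = 1.
θσ≃σ⋆I : ∀ N → θ σ ≃[ N ] σ ⋆ I
θσ≃σ⋆I N = begin
    θ σ
  ≈⟨ ≈-sym (*-identityʳ (θ σ)) ⟩
    θ σ ⋆ oneS
  ≈⟨ *-cong (≈-refl {θ σ}) (≐⇒≃ (λ n → sym (I-⋆-onePlusX n))) ⟩
    θ σ ⋆ (I ⋆ onePlusX)
  ≈⟨ solve 3 (λ t i p → t :* (i :* p) := (t :* p) :* i) (λ _ _ → refl) (θ σ) I onePlusX ⟩
    (θ σ ⋆ onePlusX) ⋆ I
  ≈⟨ *-cong (≐⇒≃ θσ-⋆-onePlusX) (≈-refl {I}) ⟩
    σ ⋆ I ∎
  where open Truncated N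

-- Chain rule: θ(f(σ)) = (θσ/σ)·(θf)(σ) = I·(θf)(σ).
atσ-θ : ∀ N f → θ (atσ N f) ≃[ N ] I ⋆ atσ N (θ f)
atσ-θ zero    f zero _ = sym (ℚP.*-identityˡ (natQ 0 * f 0))
atσ-θ (suc N) f = begin
    θ (constS (f 0) ⊕ σ ⋆ F)
  ≈⟨ ≐⇒≃ (λ n → trans (θ-⊕ (constS (f 0)) (σ ⋆ F) n) (cong₂ _+_ (θ-constS (f 0) n) (θ-Leibniz σ F n))) ⟩
    constS 0ℚ ⊕ ((θ σ ⋆ F) ⊕ (σ ⋆ θ F))
  ≈⟨ +-cong (≈-refl {constS 0ℚ}) (+-cong (*-cong (θσ≃σ⋆I (suc N)) (≈-refl {F})) (σ-⋆-lift N (atσ-θ N (tailS f)))) ⟩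
    constS 0ℚ ⊕ (((σ ⋆ I) ⋆ F) ⊕ (σ ⋆ (I ⋆ H)))
  ≈⟨ solve 4 (λ s i F H → con 0ℚ :+ (((s :* i) :* F) :+ (s :* (i :* H))) := i :* (con 0ℚ :+ s :* (H :+ F)))
       (λ _ _ → refl) σ I F H ⟩
    I ⋆ (constS 0ℚ ⊕ σ ⋆ (H ⊕ F))
  ≈⟨ *-cong (≈-refl {I}) (+-cong (≐⇒≃ (λ n → cong (λ c → constS c n) (sym (θ-constS (f 0) zero))))
       (≐⇒≃ (⋆-cong≐ {σ} {σ} (λ _ → refl) (λ n → sym (trans (atσ-cong N (tailS-θ f) n) (atσ-⊕ N (θ (tailS f)) (tailS f) n)))))) ⟩
    I ⋆ (constS (θ f 0) ⊕ σ ⋆ atσ N (tailS (θ f))) ∎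
  where
  open Truncated (suc N)
  F = atσ N (tailS f)
  H = atσ N (θ (tailS f))

atσ-X : ∀ N → atσ N X ≃[ N ] σ
atσ-X zero    zero    _ = refl
atσ-X (suc N) n _ = trans (cong (constS 0ℚ n +_)
    (trans (⋆-cong≐ {σ} {σ} {atσ N (tailS X)} {oneS} (λ _ → refl) (λ k → trans (atσ-cong N tailX k) (atσ-oneS N k)) n)
           (⋆-identityʳ σ n)))
  (constS-zero n)
  where
  tailX : tailS X ≐ oneS
  tailX zero    = refl
  tailX (suc n) = refl
  constS-zero : ∀ n → constS 0ℚ n + σ n ≡ σ n
  constS-zero zero    = refl
  constS-zero (suc n) = ℚP.+-identityˡ (σ (suc n))

onePlusσ-⋆-onePlusX : (oneS ⊕ σ) ⋆ onePlusX ≐ oneS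
onePlusσ-⋆-onePlusX n = trans (⋆-distribʳ oneS σ onePlusX n)
  (trans (cong₂ _+_ (⋆-identityˡ onePlusX n) (σ-⋆-onePlusX n)) (cancel (oneS n) (X n)))
  where
  open ℚSolver.+-*-Solver
  cancel : ∀ a b → (a + b) + - b ≡ a
  cancel = solve 2 (λ a b → (a :+ b) :+ :- b := a) refl

-- I(σ) = 1 + x: from I·(1+x) = 1, (1+x)(σ) = 1 + σ and (1 + σ)(1 + x) = 1.
I-atσ : ∀ N → atσ N I ≃[ N ] onePlusX
I-atσ N = begin
    atσ N I
  ≈⟨ ≐⇒≃ (λ n → sym (trans (⋆-cong≐ {atσ N I} {atσ N I} (λ _ → refl) onePlusσ-⋆-onePlusX n) (⋆-identityʳ (atσ N I) n))) ⟩
    atσ N I ⋆ ((oneS ⊕ σ) ⋆ onePlusX)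
  ≈⟨ *-cong (≈-refl {atσ N I}) (*-cong (≈-sym onePlusX-atσ) (≈-refl {onePlusX})) ⟩
    atσ N I ⋆ (atσ N onePlusX ⋆ onePlusX)
  ≈⟨ solve 3 (λ a b c → a :* (b :* c) := (a :* b) :* c) (λ _ _ → refl) (atσ N I) (atσ N onePlusX) onePlusX ⟩
    (atσ N I ⋆ atσ N onePlusX) ⋆ onePlusX
  ≈⟨ *-cong (≈-sym (atσ-⋆ N I onePlusX)) (≈-refl {onePlusX}) ⟩
    atσ N (I ⋆ onePlusX) ⋆ onePlusX
  ≈⟨ ≐⇒≃ (λ n → trans (⋆-cong≐ {g = onePlusX} {g' = onePlusX} (λ k → trans (atσ-cong N I-⋆-onePlusX k) (atσ-oneS N k)) (λ _ → refl) n)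
                      (⋆-identityˡ onePlusX n)) ⟩
    onePlusX ∎
  where
  open Truncated N
  onePlusX-atσ : atσ N onePlusX ≃[ N ] oneS ⊕ σ
  onePlusX-atσ = ≈-trans (≐⇒≃ (atσ-⊕ N oneS X)) (+-cong (≐⇒≃ (atσ-oneS N)) (atσ-X N))

-- L(σ) = -L, i.e. log(1 + σ) = -log(1 + x): both sides vanish at 0 and have
-- θ-derivative -x·I, by the chain rule and σ·(1+x) = -x.
L-atσ : ∀ N → atσ N L ≃[ N ] ⊖ L
L-atσ N = θ-injective N (atσ-constTerm N L) (begin
    θ (atσ N L)
  ≈⟨ atσ-θ N L ⟩
    I ⋆ atσ N (θ L)
  ≈⟨ *-cong (≈-refl {I}) (≐⇒≃ (atσ-cong N (λ n → trans (θ-L n) (sym (X-⋆ I n))))) ⟩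
    I ⋆ atσ N (X ⋆ I)
  ≈⟨ *-cong (≈-refl {I}) (≈-trans (atσ-⋆ N X I) (*-cong (atσ-X N) (I-atσ N))) ⟩
    I ⋆ (σ ⋆ onePlusX)
  ≈⟨ *-cong (≈-refl {I}) (≐⇒≃ σ-⋆-onePlusX) ⟩
    I ⋆ (⊖ X)
  ≈⟨ solve 2 (λ i x → i :* (:- x) := :- (x :* i)) (λ _ _ → refl) I X ⟩
    ⊖ (X ⋆ I)
  ≈⟨ ≐⇒≃ (λ n → sym (trans (θ-⊖ L n) (cong -_ (trans (θ-L n) (sym (X-⋆ I n)))))) ⟩
    θ (⊖ L) ∎)
  where open Truncated N

X-⋆-cancel : ∀ N {a b} → X ⋆ a ≃[ suc N ] X ⋆ b → a ≃[ N ] b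
X-⋆-cancel N {a} {b} e n n≤N = trans (sym (X-⋆ a (suc n))) (trans (e (suc n) (s≤s n≤N)) (X-⋆ b (suc n)))

-- ℓ(σ) = (1+x)ℓ: multiply by x = -σ(1+x) and use (xℓ)(σ) = σ·ℓ(σ) = L(σ) = -L.
logSeries-atσ : ∀ N → atσ N logSeries ≃[ N ] onePlusX ⋆ logSeries
logSeries-atσ N = Truncated.≈-trans N (atσ-stable N logSeries) (X-⋆-cancel N x⋆ℓ[σ])
  where
  ℓ = logSeries
  M = suc N
  ℓ[σ] = atσ M ℓ
  open Truncated M
  σ⋆ℓ[σ] : σ ⋆ ℓ[σ] ≃[ M ] ⊖ (X ⋆ ℓ)
  σ⋆ℓ[σ] = ≈-trans (≈-sym (*-cong (atσ-X M) (≈-refl {ℓ[σ]})))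
        (≈-trans (≈-sym (atσ-⋆ M X ℓ))
        (≈-trans (≐⇒≃ (atσ-cong M (X-⋆ ℓ)))
        (≈-trans (L-atσ M) (≐⇒≃ (λ n → cong -_ (sym (X-⋆ ℓ n)))))))
  x⋆ℓ[σ] : X ⋆ ℓ[σ] ≃[ M ] X ⋆ (onePlusX ⋆ ℓ)
  x⋆ℓ[σ] = begin
      X ⋆ ℓ[σ]
    ≈⟨ solve 2 (λ x c → x :* c := :- ((:- x) :* c)) (λ _ _ → refl) X ℓ[σ] ⟩
      ⊖ ((⊖ X) ⋆ ℓ[σ])
    ≈⟨ -‿cong (*-cong (≐⇒≃ (λ n → sym (σ-⋆-onePlusX n))) (≈-refl {ℓ[σ]})) ⟩
      ⊖ ((σ ⋆ onePlusX) ⋆ ℓ[σ])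
    ≈⟨ solve 3 (λ s p c → :- ((s :* p) :* c) := :- ((s :* c) :* p)) (λ _ _ → refl) σ onePlusX ℓ[σ] ⟩
      ⊖ ((σ ⋆ ℓ[σ]) ⋆ onePlusX)
    ≈⟨ -‿cong (*-cong σ⋆ℓ[σ] (≈-refl {onePlusX})) ⟩
      ⊖ ((⊖ (X ⋆ ℓ)) ⋆ onePlusX)
    ≈⟨ solve 3 (λ x l p → :- ((:- (x :* l)) :* p) := x :* (p :* l)) (λ _ _ → refl) X ℓ onePlusX ⟩
      X ⋆ (onePlusX ⋆ ℓ) ∎

powS-onePlusX-vanishes : ∀ m n → m < n → powS onePlusX m n ≡ 0ℚ
powS-onePlusX-vanishes zero    (suc n) _ = refl
powS-onePlusX-vanishes (suc m) (suc n) (s≤s m<n) = trans (onePlusX-⋆ (suc n))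
  (trans (cong₂ _+_ (powS-onePlusX-vanishes m (suc n) (ℕP.m<n⇒m<1+n m<n)) (powS-onePlusX-vanishes m n m<n))
         (ℚP.+-identityˡ 0ℚ))
  where
  onePlusX-⋆ : onePlusX ⋆ powS onePlusX m ≐ powS onePlusX m ⊕ timesX (powS onePlusX m)
  onePlusX-⋆ k = trans (⋆-comm onePlusX (powS onePlusX m) k) (⋆-onePlusX (powS onePlusX m) k)

-- [xᵐ⁺¹] f(σ)(1+x)ᵐ = (-1)ᵐ⁺¹fₘ₊₁.  The constant f₀ contributes nothing by
-- degree, and σ·(1+x) = -x peels off one factor at a time.
atσ-topCoeff : ∀ m N f → m ≤ N → (atσ (suc N) f ⋆ powS onePlusX m) (suc m) ≡ sgn (suc m) * f (suc m)
atσ-topCoeff m N f m≤N = trans (⋆-distribʳ (constS (f 0)) (σ ⋆ atσ N (tailS f)) (powS onePlusX m) (suc m))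
  (trans (cong (_+ ((σ ⋆ atσ N (tailS f)) ⋆ powS onePlusX m) (suc m))
     (trans (constS-⋆ (f 0) (powS onePlusX m) (suc m))
            (trans (cong (f 0 *_) (powS-onePlusX-vanishes m (suc m) ℕP.≤-refl)) (ℚP.*-zeroʳ (f 0)))))
  (trans (ℚP.+-identityˡ _) (σ-part m N f m≤N)))
  where
  σ-part : ∀ m N f → m ≤ N → ((σ ⋆ atσ N (tailS f)) ⋆ powS onePlusX m) (suc m) ≡ sgn (suc m) * f (suc m)
  σ-part zero N f _ = trans (⋆-identityʳ (σ ⋆ atσ N (tailS f)) 1)
    (trans (σ-⋆-suc (atσ N (tailS f)) 0) (cong (sgn 1 *_) (atσ-constTerm N (tailS f))))
  σ-part (suc m) (suc N) f (s≤s m≤N) = trans (peel (suc (suc m)) ℕP.≤-refl)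
    (trans (cong -_ (X-⋆ (F ⋆ P) (suc (suc m))))
    (trans (cong -_ (atσ-topCoeff m N (tailS f) m≤N)) (ℚP.neg-distribˡ-* (sgn (suc m)) (f (suc (suc m))))))
    where
    F = atσ (suc N) (tailS f)
    P = powS onePlusX m
    peel : (σ ⋆ F) ⋆ (onePlusX ⋆ P) ≃[ suc (suc m) ] ⊖ (X ⋆ (F ⋆ P))
    peel = begin
        (σ ⋆ F) ⋆ (onePlusX ⋆ P)
      ≈⟨ solve 4 (λ s f p q → (s :* f) :* (p :* q) := (s :* p) :* (f :* q)) (λ _ _ → refl) σ F onePlusX P ⟩
        (σ ⋆ onePlusX) ⋆ (F ⋆ P)
      ≈⟨ *-cong (≐⇒≃ σ-⋆-onePlusX) (≈-refl {F ⋆ P}) ⟩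
        (⊖ X) ⋆ (F ⋆ P)
      ≈⟨ solve 2 (λ x r → (:- x) :* r := :- (x :* r)) (λ _ _ → refl) X (F ⋆ P) ⟩
        ⊖ (X ⋆ (F ⋆ P)) ∎
      where open Truncated (suc (suc m))

-- For B = 1/ℓ: B(σ)·(1+x) = B, since B(σ)·ℓ(σ) = (Bℓ)(σ) = 1 and ℓ(σ) = (1+x)ℓ.
atσ-reciprocal : ∀ {B} → IsXOverLog B → ∀ N → atσ N B ⋆ onePlusX ≃[ N ] B
atσ-reciprocal {B} ℓB≐1 N = begin
    B[σ] ⋆ onePlusX
  ≈⟨ ≈-sym (*-identityʳ (B[σ] ⋆ onePlusX)) ⟩
    (B[σ] ⋆ onePlusX) ⋆ oneS
  ≈⟨ *-cong (≈-refl {B[σ] ⋆ onePlusX}) (≐⇒≃ (λ n → sym (ℓB≐1 n))) ⟩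
    (B[σ] ⋆ onePlusX) ⋆ (ℓ ⋆ B)
  ≈⟨ solve 4 (λ a p l b → (a :* p) :* (l :* b) := (a :* (p :* l)) :* b) (λ _ _ → refl) B[σ] onePlusX ℓ B ⟩
    (B[σ] ⋆ (onePlusX ⋆ ℓ)) ⋆ B
  ≈⟨ *-cong (≈-trans (*-cong (≈-refl {B[σ]}) (≈-sym (logSeries-atσ N))) (≈-sym (atσ-⋆ N B ℓ))) (≈-refl {B}) ⟩
    atσ N (B ⋆ ℓ) ⋆ B
  ≈⟨ *-cong (≐⇒≃ (λ n → trans (atσ-cong N (λ k → trans (⋆-comm B ℓ k) (ℓB≐1 k)) n) (atσ-oneS N n))) (≈-refl {B}) ⟩
    oneS ⋆ B
  ≈⟨ ≐⇒≃ (⋆-identityˡ B) ⟩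
    B ∎
  where
  open Truncated N
  ℓ = logSeries
  B[σ] = atσ N B

atσ-powS : ∀ {g} → (∀ N → atσ N g ⋆ onePlusX ≃[ N ] g) →
           ∀ N m → atσ N (powS g m) ⋆ powS onePlusX m ≃[ N ] powS g m
atσ-powS fixed N zero = ≐⇒≃ (λ n → trans (⋆-identityʳ (atσ N oneS) n) (atσ-oneS N n))
atσ-powS {g} fixed N (suc m) = begin
    atσ N (g ⋆ P) ⋆ (onePlusX ⋆ Q)
  ≈⟨ *-cong (atσ-⋆ N g P) (≈-refl {onePlusX ⋆ Q}) ⟩
    (atσ N g ⋆ atσ N P) ⋆ (onePlusX ⋆ Q)
  ≈⟨ solve 4 (λ b c p q → (b :* c) :* (p :* q) := (b :* p) :* (c :* q)) (λ _ _ → refl) (atσ N g) (atσ N P) onePlusX Q ⟩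
    (atσ N g ⋆ onePlusX) ⋆ (atσ N P ⋆ Q)
  ≈⟨ *-cong (fixed N) (atσ-powS fixed N m) ⟩
    g ⋆ P ∎
  where
  open Truncated N
  P = powS g m
  Q = powS onePlusX m

-- For such g, [xᵐ](gᵐ·I) = (-1)ᵐ[xᵐ]gᵐ: write gᵐI = gᵐ(σ)(1+x)ᵐ⁻¹ and read off
-- the top coefficient.
reflection : ∀ {g} → (∀ N → atσ N g ⋆ onePlusX ≃[ N ] g) →
             ∀ j → (powS g (suc j) ⋆ I) (suc j) ≡ sgn (suc j) * powS g (suc j) (suc j)
reflection {g} fixed j = trans (rewritten (suc j) ℕP.≤-refl) (atσ-topCoeff j j gᵐ ℕP.≤-refl)
  where
  m = suc j
  gᵐ = powS g m
  Q = powS onePlusX j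
  open Truncated m
  rewritten : gᵐ ⋆ I ≃[ m ] atσ m gᵐ ⋆ Q
  rewritten = begin
      gᵐ ⋆ I
    ≈⟨ *-cong (≈-sym (atσ-powS fixed m m)) (≈-refl {I}) ⟩
      (atσ m gᵐ ⋆ (onePlusX ⋆ Q)) ⋆ I
    ≈⟨ solve 4 (λ c p q i → (c :* (p :* q)) :* i := (c :* q) :* (i :* p)) (λ _ _ → refl) (atσ m gᵐ) onePlusX Q I ⟩
      (atσ m gᵐ ⋆ Q) ⋆ (I ⋆ onePlusX)
    ≈⟨ *-cong (≈-refl {atσ m gᵐ ⋆ Q}) (≐⇒≃ I-⋆-onePlusX) ⟩
      (atσ m gᵐ ⋆ Q) ⋆ oneS
    ≈⟨ *-identityʳ (atσ m gᵐ ⋆ Q) ⟩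
      atσ m gᵐ ⋆ Q ∎

-- h = (h·I)(1+x), so [xⁿ⁺¹]h = [xⁿ⁺¹](h·I) + [xⁿ](h·I).
coeff-via-I : ∀ h n → h (suc n) ≡ (h ⋆ I) (suc n) + (h ⋆ I) n
coeff-via-I h n = begin
  h (suc n)                          ≡⟨ sym (⋆-identityʳ h (suc n)) ⟩
  (h ⋆ oneS) (suc n)                 ≡⟨ ⋆-cong≐ {h} {h} (λ _ → refl) (λ k → sym (I-⋆-onePlusX k)) (suc n) ⟩
  (h ⋆ (I ⋆ onePlusX)) (suc n)       ≡⟨ sym (⋆-assoc (suc n) h I onePlusX) ⟩
  ((h ⋆ I) ⋆ onePlusX) (suc n)       ≡⟨ ⋆-onePlusX (h ⋆ I) (suc n) ⟩
  (h ⋆ I) (suc n) + (h ⋆ I) n        ∎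
  where open ≡-Reasoning

sgn-odd : ∀ m → m % 2 ≡ 1 → sgn m ≡ - 1ℚ
sgn-odd (suc zero)    _   = refl
sgn-odd (suc (suc m)) odd = trans (neg-involutive (sgn m)) (sgn-odd m odd)

suc-even-odd : ∀ m → m % 2 ≡ 0 → suc m % 2 ≡ 1
suc-even-odd zero          _    = refl
suc-even-odd (suc (suc m)) even = suc-even-odd m even

self-negative : ∀ a → a ≡ - 1ℚ * a → a ≡ 0ℚ
self-negative a h = trans (halve a) (trans (cong (λ z → ½ * (a + z)) h) (trans (cong (½ *_) (cancel a)) (ℚP.*-zeroʳ ½)))
  where
  open ℚSolver.+-*-Solver
  halve : ∀ a → a ≡ ½ * (a + a)
  halve = solve 1 (λ a → a := con ½ :* (a :+ a)) refl
  cancel : ∀ a → a + - 1ℚ * a ≡ 0ℚ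
  cancel = solve 1 (λ a → a :+ con (- 1ℚ) :* a := con 0ℚ) refl

theorem2p1 : (B : Series) → IsXOverLog B →
    ((m : ℕ) → m % 2 ≡ 1 → 1 < m → coeff (powS B m) m ≡ 0ℚ)
    × ((m : ℕ) → m % 2 ≡ 0 → 0 < m → coeff (powS B m) (suc m) ≡ 0ℚ)
theorem2p1 B ℓB≐1 = oddCase , evenCase
  where
  open RiccatiPowers B (riccati {B} ℓB≐1)
  open ≡-Reasoning
  -- [xᵐ](BᵐI) = (-1)ᵐ[xᵐ]Bᵐ, as B(σ)(1+x) = B.
  E-reflection : ∀ j → E j (suc j) ≡ sgn (suc j) * powS B (suc j) (suc j)
  E-reflection = reflection {B} (atσ-reciprocal {B} ℓB≐1)
  -- [xᵐ]Bᵐ = [xᵐ](BᵐI) + [xᵐ⁻¹](BᵐI) = -[xᵐ]Bᵐ + 0.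
  oddCase : (m : ℕ) → m % 2 ≡ 1 → 1 < m → powS B m m ≡ 0ℚ
  oddCase (suc zero)    _   (s≤s ())
  oddCase (suc (suc i)) odd _ = self-negative (powS B m m) (begin
    powS B m m                             ≡⟨ coeff-via-I (powS B m) (suc i) ⟩
    E (suc i) m + E (suc i) (suc i)        ≡⟨ cong (E (suc i) m +_) (E-diagonal i) ⟩
    E (suc i) m + 0ℚ                       ≡⟨ ℚP.+-identityʳ (E (suc i) m) ⟩
    E (suc i) m                            ≡⟨ E-reflection (suc i) ⟩
    sgn m * powS B m m                     ≡⟨ cong (_* powS B m m) (sgn-odd m odd) ⟩
    - 1ℚ * powS B m m                      ∎)
    where m = suc (suc i)
  -- [xᵐ⁺¹]Bᵐ = -m[xᵐ⁺¹](Bᵐ⁺¹I) = m[xᵐ⁺¹]Bᵐ⁺¹, and m + 1 is odd.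
  evenCase : (m : ℕ) → m % 2 ≡ 0 → 0 < m → powS B m (suc m) ≡ 0ℚ
  evenCase m even 0<m = begin
    powS B m (suc m)                                 ≡⟨ powS-offDiagonal m ⟩
    - (natQ m * E m (suc m))                         ≡⟨ cong (λ e → - (natQ m * e)) (E-reflection m) ⟩
    - (natQ m * (sgn (suc m) * powS B (suc m) (suc m)))
      ≡⟨ cong (λ b → - (natQ m * (sgn (suc m) * b))) (oddCase (suc m) (suc-even-odd m even) (s≤s 0<m)) ⟩
    - (natQ m * (sgn (suc m) * 0ℚ))                  ≡⟨ cong (λ e → - (natQ m * e)) (ℚP.*-zeroʳ (sgn (suc m))) ⟩
    - (natQ m * 0ℚ)                                  ≡⟨ cong -_ (ℚP.*-zeroʳ (natQ m)) ⟩
    0ℚ                                               ∎
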